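{- Let $(b_n)_{n\in\mathbb Z}$ be a lens sequence with constants $\alpha,\beta$. Then any two consecutive terms $a=b_n$, $b=b_{n+1}$ satisfy $$a^2+b^2=\alpha\,ab+\beta(a+b).$$
   Context: A lens sequence is a bilateral real sequence $(b_n)_{n\in\mathbb Z}$ obtained from a seed $(a,b,c)$ with $b\neq0$ placed at three consecutive positions, extended in both directions by $b_n=\alpha b_{n-1}-b_{n-2}+\beta$, where $\alpha=\frac{ab+bc+ca}{b^2}-1$ and $\beta=\frac{b^2-ac}{b}$ (the constants of the sequence). These constants do not depend on which three consecutive terms (with nonzero middle term) are used as the seed. -}

module Defs where

open import Level using (Level; _⊔_; suc)
open import Algebra.Bundles using (CommutativeRing)
open import Data.Integer as ℤ using (ℤ)
open import Relation.Nullary using (¬_)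

record Field (c ℓ : Level) : Set (suc (c ⊔ ℓ)) where
  field
    commutativeRing : CommutativeRing c ℓ
  open CommutativeRing commutativeRing public
  field
    0≉1     : ¬ (0# ≈ 1#)
    inv     : (x : Carrier) → ¬ (x ≈ 0#) → Carrier
    inverse : (x : Carrier) (p : ¬ (x ≈ 0#)) → x * inv x p ≈ 1#

module _ {c ℓ : Level} (F : Field c ℓ) where
  open Field F

  lensα : (a b c : Carrier) → ¬ (b ≈ 0#) → Carrier
  lensα a b c b≉0 =
    ((a * b + b * c + c * a) * (inv b b≉0 * inv b b≉0)) - 1#

  lensβ : (a b c : Carrier) → ¬ (b ≈ 0#) → Carrier
  lensβ a b c b≉0 = (b * b - a * c) * inv b b≉0

  seqα : (s : ℤ → Carrier) (k : ℤ) → ¬ (s k ≈ 0#) → Carrier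
  seqα s k nz = lensα (s (k ℤ.- ℤ.1ℤ)) (s k) (s (k ℤ.+ ℤ.1ℤ)) nz

  seqβ : (s : ℤ → Carrier) (k : ℤ) → ¬ (s k ≈ 0#) → Carrier
  seqβ s k nz = lensβ (s (k ℤ.- ℤ.1ℤ)) (s k) (s (k ℤ.+ ℤ.1ℤ)) nz

  IsLensFrom : (s : ℤ → Carrier) (k : ℤ) → ¬ (s k ≈ 0#) → Set ℓ
  IsLensFrom s k nz =
    ∀ (n : ℤ) → s n ≈ seqα s k nz * s (n ℤ.- ℤ.1ℤ)
                      - s (n ℤ.- ℤ.1ℤ ℤ.- ℤ.1ℤ) + seqβ s k nz

{-# OPTIONS --safe #-}
module Submission where

-- The form Q(x,y) = x² + y² − αxy − β(x+y) is invariant under the step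
-- (x,y) ↦ (y, αy − x + β) of the recurrence, because
-- Q(y,z) − Q(x,y) = (z − x)(z + x − αy − β); and the definitions of α and β
-- are exactly what makes Q vanish on the seed pair. Propagating the relation
-- Q = 0 along ℤ in both directions from the seed gives it at every pair.

open import Defs
open import Level using (Level)
open import Algebra.Bundles using (CommutativeRing)
import Algebra.Properties.Group as GroupProperties
open import Data.Integer as ℤ using (ℤ; +_; -[1+_]; 0ℤ; 1ℤ)
open import Data.Integer.Tactic.RingSolver using (solve-∀)
open import Data.Nat using (suc)
import Data.Nat.Properties as ℕ
open import Function.Bundles using (_⇔_; mk⇔; Equivalence)
import Function.Properties.Equivalence as ⇔
open import Relation.Nullary using (¬_)
open import Relation.Binary.PropositionalEquality using (_≡_; subst)
import Relation.Binary.Reasoning.Setoid as SetoidReasoning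

module _ {p} {P : ℤ → Set p} (step : ∀ n → P (n ℤ.- 1ℤ) ⇔ P n) where

  ⇔-0ℤ : ∀ n → P n ⇔ P 0ℤ
  ⇔-0ℤ (+ 0)        = ⇔.refl
  ⇔-0ℤ (+ suc j)    = ⇔.trans (⇔.sym (step (+ suc j))) (⇔-0ℤ (+ j))
  ⇔-0ℤ -[1+ 0 ]     = step 0ℤ
  ⇔-0ℤ -[1+ suc j ] =
    ⇔.trans (subst (λ m → P -[1+ suc m ] ⇔ P -[1+ j ]) (ℕ.+-identityʳ j) (step -[1+ j ]))
            (⇔-0ℤ -[1+ j ])

  all-from-one : ∀ {m} → P m → ∀ n → P n
  all-from-one {m} Pm n = Equivalence.from (⇔-0ℤ n) (Equivalence.to (⇔-0ℤ m) Pm)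

module LensConic {c ℓ} (R : CommutativeRing c ℓ) where
  open CommutativeRing R
  open GroupProperties +-group using (//-rightDividesˡ; ∙-cancelʳ)
  open import Algebra.Solver.Ring.NaturalCoefficients.Default commutativeSemiring
  open SetoidReasoning setoid

  OnLensConic : (α β x y : Carrier) → Set ℓ
  OnLensConic α β x y = x * x + y * y ≈ α * (x * y) + β * (x + y)

  *-cancelˡ-invertible : ∀ {b i x y} → b * i ≈ 1# → b * x ≈ b * y → x ≈ y
  *-cancelˡ-invertible {b} {i} {x} {y} bi≈1 bx≈by = begin
    x             ≈⟨ *-identityˡ x ⟨
    1# * x        ≈⟨ *-congʳ (sym bi≈1) ⟩
    (b * i) * x   ≈⟨ solve 3 (λ b i x → (b :* i) :* x := i :* (b :* x)) refl b i x ⟩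
    i * (b * x)   ≈⟨ *-congˡ bx≈by ⟩
    i * (b * y)   ≈⟨ solve 3 (λ b i y → i :* (b :* y) := (b :* i) :* y) refl b i y ⟩
    (b * i) * y   ≈⟨ *-congʳ bi≈1 ⟩
    1# * y        ≈⟨ *-identityˡ y ⟩
    y             ∎

  cross-cancel : ∀ {a b c d} → a + d ≈ c + b → c ≈ d → a ≈ b
  cross-cancel {a} {b} {c} {d} a+d≈c+b c≈d =
    ∙-cancelʳ d a b (trans a+d≈c+b (trans (+-congʳ c≈d) (+-comm d b)))

  recurrence⇒sum : ∀ {α β x y z} → z ≈ α * y - x + β → z + x ≈ α * y + β
  recurrence⇒sum {α} {β} {x} {y} {z} z≈ = begin
    z + x                  ≈⟨ +-congʳ z≈ ⟩
    (α * y - x + β) + x    ≈⟨ solve 4 (λ p m β x → (p :+ m :+ β) :+ x := (p :+ m :+ x) :+ β) refl (α * y) (- x) β x ⟩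
    (α * y - x + x) + β    ≈⟨ +-congʳ (//-rightDividesˡ x (α * y)) ⟩
    α * y + β              ∎

  -- With w = αy + β = z + x, both z² + xw and x² + zw equal x² + xz + z².
  lensConic-balance : ∀ {α β x y z} → z + x ≈ α * y + β →
    (y * y + z * z) + (α * (x * y) + β * (x + y)) ≈ (x * x + y * y) + (α * (y * z) + β * (y + z))
  lensConic-balance {α} {β} {x} {y} {z} z+x≈w = begin
    (y * y + z * z) + (α * (x * y) + β * (x + y))
      ≈⟨ solve 5 (λ α β x y z → (y :* y :+ z :* z) :+ (α :* (x :* y) :+ β :* (x :+ y))
                               := (z :* z :+ x :* (α :* y :+ β)) :+ (y :* y :+ β :* y)) refl α β x y z ⟩
    (z * z + x * (α * y + β)) + (y * y + β * y)
      ≈⟨ +-congʳ (+-congˡ (*-congˡ (sym z+x≈w))) ⟩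
    (z * z + x * (z + x)) + (y * y + β * y)
      ≈⟨ +-congʳ (solve 2 (λ x z → z :* z :+ x :* (z :+ x) := x :* x :+ z :* (z :+ x)) refl x z) ⟩
    (x * x + z * (z + x)) + (y * y + β * y)
      ≈⟨ +-congʳ (+-congˡ (*-congˡ z+x≈w)) ⟩
    (x * x + z * (α * y + β)) + (y * y + β * y)
      ≈⟨ solve 5 (λ α β x y z → (x :* x :+ z :* (α :* y :+ β)) :+ (y :* y :+ β :* y)
                               := (x :* x :+ y :* y) :+ (α :* (y :* z) :+ β :* (y :+ z))) refl α β x y z ⟩
    (x * x + y * y) + (α * (y * z) + β * (y + z))
      ∎

  onLensConic-step : ∀ {α β x y z} → z ≈ α * y - x + β →
                     OnLensConic α β x y ⇔ OnLensConic α β y z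
  onLensConic-step z≈ = mk⇔ (cross-cancel balance) (cross-cancel (sym balance))
    where balance = lensConic-balance (recurrence⇒sum z≈)

  -- Stated with α and β cleared of subtraction and division, and proved after
  -- multiplying by b and adding a cancellable term, so that every identity is
  -- one the semiring solver can check.
  onLensConic-seed : ∀ {α β a b c i} → b * i ≈ 1# →
                     (α + 1#) * (b * b) ≈ a * b + b * c + c * a →
                     β * b + a * c ≈ b * b →
                     OnLensConic α β a b
  onLensConic-seed {α} {β} {a} {b} {c} bi≈1 α-eq β-eq =
    *-cancelˡ-invertible bi≈1 (∙-cancelʳ (a * b * b + a * c * a + a * c * b) _ _ (begin
      b * (a * a + b * b) + (a * b * b + a * c * a + a * c * b)
        ≈⟨ solve 3 (λ a b c → b :* (a :* a :+ b :* b) :+ (a :* b :* b :+ a :* c :* a :+ a :* c :* b)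
                             := a :* (a :* b :+ b :* c :+ c :* a) :+ (a :+ b) :* (b :* b)) refl a b c ⟩
      a * (a * b + b * c + c * a) + (a + b) * (b * b)
        ≈⟨ +-cong (*-congˡ (sym α-eq)) (*-congˡ (sym β-eq)) ⟩
      a * ((α + 1#) * (b * b)) + (a + b) * (β * b + a * c)
        ≈⟨ solve 5 (λ α β a b c → a :* ((α :+ con 1) :* (b :* b)) :+ (a :+ b) :* (β :* b :+ a :* c)
                                 := b :* (α :* (a :* b) :+ β :* (a :+ b)) :+ (a :* b :* b :+ a :* c :* a :+ a :* c :* b))
                   refl α β a b c ⟩
      b * (α * (a * b) + β * (a + b)) + (a * b * b + a * c * a + a * c * b)
        ∎))

module _ {c ℓ : Level} (F : Field c ℓ) where
  open Field F
  open LensConic commutativeRing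
  open GroupProperties +-group using (//-rightDividesˡ)
  open import Algebra.Solver.Ring.NaturalCoefficients.Default commutativeSemiring
  open SetoidReasoning setoid

  lensα+1-cleared : ∀ a b c (b≉0 : ¬ (b ≈ 0#)) →
                    (lensα F a b c b≉0 + 1#) * (b * b) ≈ a * b + b * c + c * a
  lensα+1-cleared a b c b≉0 = begin
    (u * (i * i) - 1# + 1#) * (b * b)  ≈⟨ *-congʳ (//-rightDividesˡ 1# (u * (i * i))) ⟩
    u * (i * i) * (b * b)              ≈⟨ solve 3 (λ u i b → u :* (i :* i) :* (b :* b) := u :* ((b :* i) :* (b :* i))) refl u i b ⟩
    u * ((b * i) * (b * i))            ≈⟨ *-congˡ (*-cong bi≈1 bi≈1) ⟩
    u * (1# * 1#)                      ≈⟨ solve 1 (λ u → u :* (con 1 :* con 1) := u) refl u ⟩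
    u                                  ∎
    where
      u = a * b + b * c + c * a
      i = inv b b≉0
      bi≈1 = inverse b b≉0

  lensβ-cleared : ∀ a b c (b≉0 : ¬ (b ≈ 0#)) →
                  lensβ F a b c b≉0 * b + a * c ≈ b * b
  lensβ-cleared a b c b≉0 = begin
    (b * b - a * c) * i * b + a * c    ≈⟨ +-congʳ (solve 3 (λ d i b → d :* i :* b := d :* (b :* i)) refl (b * b - a * c) i b) ⟩
    (b * b - a * c) * (b * i) + a * c  ≈⟨ +-congʳ (*-congˡ (inverse b b≉0)) ⟩
    (b * b - a * c) * 1# + a * c       ≈⟨ +-congʳ (*-identityʳ _) ⟩
    (b * b - a * c) + a * c            ≈⟨ //-rightDividesˡ (a * c) (b * b) ⟩
    b * b                              ∎
    where i = inv b b≉0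

  seed-onLensConic : ∀ a b c (b≉0 : ¬ (b ≈ 0#)) →
                     OnLensConic (lensα F a b c b≉0) (lensβ F a b c b≉0) a b
  seed-onLensConic a b c b≉0 =
    onLensConic-seed (inverse b b≉0) (lensα+1-cleared a b c b≉0) (lensβ-cleared a b c b≉0)

n+1-1≡n : ∀ n → n ℤ.+ 1ℤ ℤ.- 1ℤ ≡ n
n+1-1≡n = solve-∀

proposition4p4 : {c ℓ : Level} (F : Field c ℓ) →
    let open Field F in
    (s : ℤ → Carrier) (k : ℤ) (nz : ¬ (s k ≈ 0#)) →
    IsLensFrom F s k nz →
    ∀ (n : ℤ) →
      s n * s n + s (n ℤ.+ ℤ.1ℤ) * s (n ℤ.+ ℤ.1ℤ)
        ≈ seqα F s k nz * (s n * s (n ℤ.+ ℤ.1ℤ))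
          + seqβ F s k nz * (s n + s (n ℤ.+ ℤ.1ℤ))
proposition4p4 F s k nz recurrence n =
  subst (λ m → OnLensConic α β (s m) (s (n ℤ.+ 1ℤ))) (n+1-1≡n n)
        (all-from-one (λ m → onLensConic-step (recurrence m))
                      (seed-onLensConic F (s (k ℤ.- 1ℤ)) (s k) (s (k ℤ.+ 1ℤ)) nz)
                      (n ℤ.+ 1ℤ))
  where
    open Field F using (commutativeRing)
    open LensConic commutativeRing using (OnLensConic; onLensConic-step)
    α = seqα F s k nz
    β = seqβ F s k nz
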